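{- There exists a Hadamard matrix of order $764$, i.e. a $764\times 764$ matrix $A$ with all entries in $\{1,-1\}$ such that $AA^T = 764\, I_{764}$.
   Context: $A^T$ denotes the transpose of $A$ and $I_m$ the $m\times m$ identity matrix. -}

module Defs where

open import Data.Nat using (ℕ)
open import Data.Integer using (ℤ; +_; _*_; -[1+_])
open import Data.Fin using (Fin)
open import Data.Sum using (_⊎_)
open import Data.Product using (_×_)
open import Relation.Nullary using (yes; no)
import Data.Fin
open import Data.Vec.Functional using (foldr)
open import Relation.Binary.PropositionalEquality using (_≡_)
import Data.Integer as ℤ

Matrix : ℕ → ℕ → Set
Matrix m n = Fin m → Fin n → ℤ

∑ : {n : ℕ} → (Fin n → ℤ) → ℤ
∑ f = foldr ℤ._+_ (+ 0) f

_ᵀ : {m n : ℕ} → Matrix m n → Matrix n m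
(A ᵀ) j i = A i j

_·_ : {m n p : ℕ} → Matrix m n → Matrix n p → Matrix m p
(A · B) i k = ∑ (λ j → A i j * B j k)

I : (n : ℕ) → Matrix n n
I n i j with i Data.Fin.≟ j
... | yes _ = + 1
... | no _ = + 0

_•_ : {m n : ℕ} → ℤ → Matrix m n → Matrix m n
(c • A) i j = c * A i j

IsHadamard : (n : ℕ) → Matrix n n → Set
IsHadamard n A =
  (∀ i j → A i j ≡ + 1 ⊎ A i j ≡ -[1+ 0 ]) ×
  (∀ i j → (A · (A ᵀ)) i j ≡ ((+ n) • I n) i j)

module Submission where

-- Goethals–Seidel: let a, b, c, d be n-periodic ±1 sequences whose periodic autocorrelations
-- add up to 0 at every nonzero shift, A, B, C, D their circulants and R the permutation matrix
-- of s ↦ -s.  Since XR = RXᵀ for every circulant X, each block of H Hᵀ, for H the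
-- Goethals–Seidel array, is a signed sum of four periodic correlations or convolutions of two
-- of the sequences.  On the diagonal these are the four autocorrelations, which add up to 4n I;
-- off the diagonal they cancel in pairs because convolution is commutative.  For n = 191
-- suitable sequences exist, and the hypothesis on them is a computation of 190 autocorrelation
-- sums.

open import Data.Bool using (Bool; true; false; if_then_else_; _∨_)
open import Data.Fin as Fin using (Fin; toℕ; combine; remQuot; _↑ˡ_; _↑ʳ_; inject₁; fromℕ; opposite)
open import Data.Fin.Patterns using (0F; 1F; 2F; 3F)
open import Data.Fin.Permutation using (reverse)
open import Data.Fin.Properties
  using (remQuot-combine; combine-remQuot; toℕ-inject₁; toℕ-fromℕ; opposite-prop; toℕ<n; toℕ-injective; toℕ-fromℕ<; all?)
open import Data.Integer using (ℤ; +_; -[1+_]; 0ℤ; 1ℤ; -1ℤ; _+_; _-_; -_; _*_; _⊖_; _%ℕ_)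
import Data.Integer.Properties as ℤ
open import Algebra.Properties.CommutativeMonoid.Sum ℤ.+-0-commutativeMonoid
  using (sum-cong-≗; sum-init-last; ∑-permute)
open import Data.Integer.Tactic.RingSolver using (solve-∀)
open import Data.List using (List; []; _∷_)
open import Data.Nat as ℕ using (ℕ; zero; suc; _∸_; _%_; _<_; _≡ᵇ_; NonZero; z<s)
import Data.Nat.Properties as ℕ
open import Data.Nat.DivMod using ([m+n]%n≡m%n; m<n⇒m%n≡m; n%n≡0; m%n<n)
open import Data.Product using (∃; _,_)
open import Data.Product.Properties using (≡-dec)
open import Data.Sign.Base as Sign using (Sign)
open import Data.Sum using (_⊎_; inj₁; inj₂)
open import Function using (_∘_)
open import Relation.Binary.Definitions using (tri<; tri≈; tri>)
open import Relation.Binary.PropositionalEquality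
open import Relation.Nullary using (yes; no; contradiction)
open import Relation.Nullary.Decidable using (toWitness)
open import Defs

-- Sums and block matrices

∑-cong : ∀ {n} {f g : Fin n → ℤ} → (∀ i → f i ≡ g i) → ∑ f ≡ ∑ g
∑-cong = sum-cong-≗

∑-neg : ∀ {n} (f : Fin n → ℤ) → ∑ (λ i → - f i) ≡ - ∑ f
∑-neg {zero}  f = refl
∑-neg {suc n} f = trans (cong (λ v → - f 0F + v) (∑-neg (f ∘ Fin.suc))) (sym (ℤ.neg-distrib-+ (f 0F) _))

∑-↑ : ∀ m k (f : Fin (m ℕ.+ k) → ℤ) → ∑ f ≡ ∑ (λ i → f (i ↑ˡ k)) + ∑ (λ j → f (m ↑ʳ j))
∑-↑ zero    k f = sym (ℤ.+-identityˡ _)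
∑-↑ (suc m) k f = trans (cong (λ v → f 0F + v) (∑-↑ m k (f ∘ Fin.suc))) (sym (ℤ.+-assoc (f 0F) _ _))

∑-combine : ∀ a m (f : Fin (a ℕ.* m) → ℤ) → ∑ f ≡ ∑ {a} (λ p → ∑ {m} (λ r → f (combine p r)))
∑-combine zero    m f = refl
∑-combine (suc a) m f =
  trans (∑-↑ m (a ℕ.* m) f) (cong (λ v → ∑ (λ r → f (r ↑ˡ (a ℕ.* m))) + v) (∑-combine a m (λ j → f (m ↑ʳ j))))

blockMatrix : ∀ {a b m n} → (Fin a → Fin b → Matrix m n) → Matrix (a ℕ.* m) (b ℕ.* n)
blockMatrix {a} {b} {m} {n} X i j = let (p , r) = remQuot {a} m i; (q , s) = remQuot {b} n j in X p q r s

blockMatrix-combine : ∀ {a b m n} (X : Fin a → Fin b → Matrix m n) p q r s →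
                      blockMatrix X (combine p r) (combine q s) ≡ X p q r s
blockMatrix-combine {m = m} {n} X p q r s =
  cong₂ (λ (p , r) (q , s) → X p q r s) (remQuot-combine {k = m} p r) (remQuot-combine {k = n} q s)

·ᵀ-blockMatrix : ∀ {a b m n} (X Y : Fin a → Fin b → Matrix m n) p r p' r' →
                 (blockMatrix X · (blockMatrix Y ᵀ)) (combine p r) (combine p' r') ≡ ∑ (λ q → (X p q · (Y p' q ᵀ)) r r')
·ᵀ-blockMatrix {b = b} {n = n} X Y p r p' r' =
  trans (∑-combine b n (λ j → blockMatrix X (combine p r) j * blockMatrix Y (combine p' r') j))
        (∑-cong (λ q → ∑-cong (λ s → cong₂ _*_ (blockMatrix-combine X p q r s) (blockMatrix-combine Y p' q r' s))))

blockMatrix-entries : ∀ {a b m n} {P : ℤ → Set} (X : Fin a → Fin b → Matrix m n) →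
                      (∀ p q r s → P (X p q r s)) → ∀ i j → P (blockMatrix X i j)
blockMatrix-entries X h i j = h _ _ _ _

combine-injective : ∀ {a m} (p : Fin a) (r : Fin m) p' r' → combine p r ≡ combine p' r' → (p , r) ≡ (p' , r')
combine-injective {m = m} p r p' r' eq =
  trans (sym (remQuot-combine p r)) (trans (cong (remQuot m) eq) (remQuot-combine p' r'))

∀-combine₂ : ∀ {a m} {P : Fin (a ℕ.* m) → Fin (a ℕ.* m) → Set} →
             (∀ (p : Fin a) (r : Fin m) (p' : Fin a) (r' : Fin m) → P (combine p r) (combine p' r')) → ∀ i k → P i k
∀-combine₂ {a} {m} {P} h i k = subst₂ P (combine-remQuot {a} m i) (combine-remQuot {a} m k) (h _ _ _ _)

•I-diagonal : ∀ {N} c (i : Fin N) → (c • I N) i i ≡ c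
•I-diagonal c i with i Fin.≟ i
... | yes _   = ℤ.*-identityʳ c
... | no i≢i  = contradiction refl i≢i

•I-offDiagonal : ∀ {N} c {i k : Fin N} → i ≢ k → (c • I N) i k ≡ 0ℤ
•I-offDiagonal c {i} {k} i≢k with i Fin.≟ k
... | yes i≡k = contradiction i≡k i≢k
... | no _    = ℤ.*-zeroʳ c

-- Periodic sequences

record Periodic (n : ℕ) (f : ℤ → ℤ) : Set where
  constructor periodic
  field period : ∀ u → f (u + + n) ≡ f u

open Periodic

period⁻ : ∀ {n f} → Periodic n f → ∀ u → f (u - + n) ≡ f u
period⁻ {n} {f} pf u = trans (sym (period pf (u - + n))) (cong f (cancel u (+ n)))
  where cancel : ∀ a b → a - b + b ≡ a
        cancel = solve-∀

periodic-shift : ∀ {n f} → Periodic n f → ∀ c → Periodic n (λ u → f (u + c))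
periodic-shift {n} {f} pf c = periodic (λ u → trans (cong f (swap u (+ n) c)) (period pf (u + c)))
  where swap : ∀ a b c → a + b + c ≡ a + c + b
        swap = solve-∀

periodic-reflect : ∀ {n f} → Periodic n f → ∀ c → Periodic n (λ u → f (c - u))
periodic-reflect {n} {f} pf c = periodic (λ u → trans (cong f (assoc c u (+ n))) (period⁻ pf (c - u)))
  where assoc : ∀ a b m → a - (b + m) ≡ a - b - m
        assoc = solve-∀

periodic-* : ∀ {n f g} → Periodic n f → Periodic n g → Periodic n (λ u → f u * g u)
periodic-* pf pg = periodic (λ u → cong₂ _*_ (period pf u) (period pg u))

-[1+]%ℕ : ∀ k d .{{_ : NonZero d}} → -[1+ k ] %ℕ d ≡ (d ∸ suc k % d) % d
-[1+]%ℕ k d with suc k % d | m%n<n (suc k) d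
... | zero  | _   = sym (n%n≡0 d)
... | suc r | r<d = sym (m<n⇒m%n≡m (ℕ.∸-monoʳ-< z<s (ℕ.<⇒≤ r<d)))

%ℕ-periodic : ∀ d .{{_ : NonZero d}} u → (u + + d) %ℕ d ≡ u %ℕ d
%ℕ-periodic d (+ k)    = [m+n]%n≡m%n k d
%ℕ-periodic d -[1+ k ] with ℕ.<-cmp (suc k) d
... | tri< k<d _ _ = begin
  (d ⊖ suc k) %ℕ d          ≡⟨ cong (_%ℕ d) (ℤ.⊖-≥ (ℕ.<⇒≤ k<d)) ⟩
  (d ∸ suc k) % d           ≡⟨ cong (λ m → (d ∸ m) % d) (m<n⇒m%n≡m k<d) ⟨
  (d ∸ suc k % d) % d       ≡⟨ -[1+]%ℕ k d ⟨
  -[1+ k ] %ℕ d             ∎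
  where open ≡-Reasoning
... | tri≈ _ refl _ = begin
  (suc k ⊖ suc k) %ℕ d      ≡⟨ cong (_%ℕ d) (ℤ.n⊖n≡0 (suc k)) ⟩
  0                         ≡⟨ n%n≡0 d ⟨
  (d ∸ 0) % d               ≡⟨ cong (λ m → (d ∸ m) % d) (n%n≡0 d) ⟨
  (d ∸ suc k % d) % d       ≡⟨ -[1+]%ℕ k d ⟨
  -[1+ k ] %ℕ d             ∎
  where open ≡-Reasoning
... | tri> _ _ d<k = begin
  (d ⊖ suc k) %ℕ d          ≡⟨ cong (_%ℕ d) (ℤ.⊖-< d<k) ⟩
  - + (suc k ∸ d) %ℕ d      ≡⟨ cong (λ m → - + m %ℕ d) (ℕ.+-∸-assoc 1 {k} {d} (ℕ.s≤s⁻¹ d<k)) ⟩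
  -[1+ (k ∸ d) ] %ℕ d       ≡⟨ -[1+]%ℕ (k ∸ d) d ⟩
  (d ∸ suc (k ∸ d) % d) % d ≡⟨ cong (λ m → (d ∸ m) % d) (suc[k∸d]%d≡suc[k]%d) ⟩
  (d ∸ suc k % d) % d       ≡⟨ -[1+]%ℕ k d ⟨
  -[1+ k ] %ℕ d             ∎
  where open ≡-Reasoning
        suc[k∸d]%d≡suc[k]%d : suc (k ∸ d) % d ≡ suc k % d
        suc[k∸d]%d≡suc[k]%d =
          trans (sym ([m+n]%n≡m%n (suc (k ∸ d)) d)) (cong (λ m → suc m % d) (ℕ.m∸n+n≡m (ℕ.s≤s⁻¹ d<k)))

periodic-%ℕ : ∀ n .{{_ : NonZero n}} (y : ℕ → ℤ) → Periodic n (λ u → y (u %ℕ n))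
periodic-%ℕ n y = periodic (λ u → cong y (%ℕ-periodic n u))

∑< : ℕ → (ℤ → ℤ) → ℤ
∑< n f = ∑ {n} (λ s → f (+ toℕ s))

∑<-cong : ∀ {n f g} → (∀ u → f u ≡ g u) → ∑< n f ≡ ∑< n g
∑<-cong {n} f≗g = ∑-cong {n} (λ i → f≗g (+ toℕ i))

∑<-1 : ∀ n → ∑< n (λ _ → 1ℤ) ≡ + n
∑<-1 zero    = refl
∑<-1 (suc n) = cong (_+_ 1ℤ) (∑<-1 n)

∑<-rotate : ∀ {n f} → Periodic n f → ∑< n (λ s → f (1ℤ + s)) ≡ ∑< n f
∑<-rotate {zero}  pf = refl
∑<-rotate {suc m} {f} pf = begin
  ∑< (suc m) (λ s → f (1ℤ + s))
    ≡⟨ sum-init-last {m} (λ i → f (1ℤ + + toℕ i)) ⟩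
  ∑ {m} (λ i → f (+ suc (toℕ (inject₁ i)))) + f (+ suc (toℕ (fromℕ m)))
    ≡⟨ cong₂ _+_ (∑-cong {m} (λ i → cong (f ∘ +_ ∘ suc) (toℕ-inject₁ i)))
                 (trans (cong (f ∘ +_ ∘ suc) (toℕ-fromℕ m)) (period pf 0ℤ)) ⟩
  ∑ {m} (λ i → f (+ suc (toℕ i))) + f 0ℤ
    ≡⟨ ℤ.+-comm _ (f 0ℤ) ⟩
  ∑< (suc m) f ∎
  where open ≡-Reasoning

∑<-shift⁺ : ∀ {n f} → Periodic n f → ∀ k → ∑< n (λ s → f (s + + k)) ≡ ∑< n f
∑<-shift⁺ {n} {f} pf zero    = ∑<-cong {n} (λ u → cong f (ℤ.+-identityʳ u))
∑<-shift⁺ {n} {f} pf (suc k) = begin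
  ∑< n (λ s → f (s + + suc k))    ≡⟨ ∑<-cong {n} (λ u → cong f (assoc u (+ k))) ⟩
  ∑< n (λ s → f (1ℤ + s + + k))   ≡⟨ ∑<-rotate (periodic-shift pf (+ k)) ⟩
  ∑< n (λ s → f (s + + k))        ≡⟨ ∑<-shift⁺ pf k ⟩
  ∑< n f                          ∎
  where open ≡-Reasoning
        assoc : ∀ a b → a + (1ℤ + b) ≡ 1ℤ + a + b
        assoc = solve-∀

∑<-shift : ∀ {n f} → Periodic n f → ∀ c → ∑< n (λ s → f (s + c)) ≡ ∑< n f
∑<-shift pf (+ k) = ∑<-shift⁺ pf k
∑<-shift {n} {f} pf c@(-[1+ k ]) = sym (begin
  ∑< n f                             ≡⟨ ∑<-cong {n} (λ u → cong f (cancel u (+ suc k))) ⟩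
  ∑< n (λ s → f (s + + suc k + c))   ≡⟨ ∑<-shift⁺ (periodic-shift pf c) (suc k) ⟩
  ∑< n (λ s → f (s + c))             ∎)
  where open ≡-Reasoning
        cancel : ∀ a b → a ≡ a + b + - b
        cancel = solve-∀

∑<-neg : ∀ {n f} → Periodic n f → ∑< n (λ s → f (- s)) ≡ ∑< n f
∑<-neg {n} {f} pf = sym (begin
  ∑< n f                                ≡⟨ ∑-permute {n} {n} (λ i → f (+ toℕ i)) reverse ⟩
  ∑ {n} (λ i → f (+ toℕ (opposite i)))   ≡⟨ ∑-cong {n} (λ i → trans (cong f (opposite≡ i)) (period pf _)) ⟩
  ∑< n (λ s → f (- (1ℤ + s)))            ≡⟨ ∑<-rotate {n} {f ∘ -_} (periodic period⁻′) ⟩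
  ∑< n (λ s → f (- s))                   ∎)
  where open ≡-Reasoning
        opposite≡ : ∀ (i : Fin n) → + toℕ (opposite i) ≡ - (1ℤ + + toℕ i) + + n
        opposite≡ i = trans (cong +_ (opposite-prop i)) (sym (ℤ.⊖-≥ (toℕ<n i)))
        period⁻′ : ∀ u → f (- (u + + n)) ≡ f (- u)
        period⁻′ u = trans (cong f (ℤ.neg-distrib-+ u (+ n))) (period⁻ pf (- u))

∑<-reflect : ∀ {n f} → Periodic n f → ∀ c → ∑< n (λ s → f (c - s)) ≡ ∑< n f
∑<-reflect {n} {f} pf c = begin
  ∑< n (λ s → f (c - s))   ≡⟨ ∑<-neg {n} {λ u → f (c + u)} (periodic period′) ⟩
  ∑< n (λ s → f (c + s))   ≡⟨ ∑<-cong {n} (λ u → cong f (ℤ.+-comm c u)) ⟩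
  ∑< n (λ s → f (s + c))   ≡⟨ ∑<-shift pf c ⟩
  ∑< n f                   ∎
  where open ≡-Reasoning
        period′ : ∀ u → f (c + (u + + n)) ≡ f (c + u)
        period′ u = trans (cong f (sym (ℤ.+-assoc c u (+ n)))) (period pf (c + u))

record Reindexing (n : ℕ) (i : ℤ → ℤ) : Set where
  constructor reindexing
  field reindex : ∀ {g} → Periodic n g → ∑< n (g ∘ i) ≡ ∑< n g

open Reindexing

shift-reindexing : ∀ {n} c → Reindexing n (λ u → u + c)
shift-reindexing c = reindexing (λ pg → ∑<-shift pg c)

reflect-reindexing : ∀ {n} c → Reindexing n (λ u → c - u)
reflect-reindexing c = reindexing (λ pg → ∑<-reflect pg c)

±1 : ℤ → Set
±1 z = z ≡ 1ℤ ⊎ z ≡ -1ℤ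

±1-square : ∀ {z} → ±1 z → z * z ≡ 1ℤ
±1-square (inj₁ refl) = refl
±1-square (inj₂ refl) = refl

module Correlation (n : ℕ) where

  corr conv : (ℤ → ℤ) → (ℤ → ℤ) → ℤ → ℤ
  corr x y k = ∑< n (λ u → x u * y (u + k))
  conv x y k = ∑< n (λ u → x u * y (k - u))

  ∑-as-corr : ∀ {x y i j : ℤ → ℤ} → Periodic n x → Periodic n y → Reindexing n i →
              ∀ k → (∀ s → j s ≡ i s + k) →
              ∑< n (λ s → x (i s) * y (j s)) ≡ corr x y k
  ∑-as-corr {x} {y} {i} px py ri k j≡i+k =
    trans (∑<-cong {n} (λ s → cong (λ v → x (i s) * y v) (j≡i+k s))) (reindex ri (periodic-* px (periodic-shift py k)))

  ∑-as-corrᵀ : ∀ {x y i j : ℤ → ℤ} → Periodic n x → Periodic n y → Reindexing n i →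
               ∀ k → (∀ s → j s ≡ i s + k) →
               ∑< n (λ s → x (j s) * y (i s)) ≡ corr y x k
  ∑-as-corrᵀ {x} {y} {i} {j} px py ri k j≡i+k =
    trans (∑<-cong {n} (λ s → ℤ.*-comm (x (j s)) (y (i s)))) (∑-as-corr py px ri k j≡i+k)

  ∑-as-conv : ∀ {x y i j : ℤ → ℤ} → Periodic n x → Periodic n y → Reindexing n i →
              ∀ k → (∀ s → j s ≡ k - i s) →
              ∑< n (λ s → x (i s) * y (j s)) ≡ conv x y k
  ∑-as-conv {x} {y} {i} px py ri k j≡k-i =
    trans (∑<-cong {n} (λ s → cong (λ v → x (i s) * y v) (j≡k-i s))) (reindex ri (periodic-* px (periodic-reflect py k)))

  corr-swap : ∀ {x y : ℤ → ℤ} → Periodic n x → Periodic n y → ∀ k → corr x y k ≡ corr y x (- k)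
  corr-swap {x} {y} px py k = ∑-as-corrᵀ {x} {y} px py (shift-reindexing k) (- k) (λ u → cancel u k)
    where cancel : ∀ a b → a ≡ a + b + - b
          cancel = solve-∀

  conv-comm : ∀ {x y : ℤ → ℤ} → Periodic n x → Periodic n y → ∀ k → conv x y k ≡ conv y x k
  conv-comm {x} {y} px py k = trans (∑<-cong {n} (λ u → ℤ.*-comm (x u) (y (k - u))))
                                    (∑-as-conv py px (reflect-reindexing k) k (λ u → involutive u k))
    where involutive : ∀ a b → a ≡ b - (b - a)
          involutive = solve-∀

  corr-self : ∀ {x : ℤ → ℤ} → (∀ u → ±1 (x u)) → corr x x 0ℤ ≡ + n
  corr-self {x} ±1-valued =
    trans (∑<-cong {n} (λ u → trans (cong (λ v → x u * x v) (ℤ.+-identityʳ u)) (±1-square (±1-valued u)))) (∑<-1 n)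

pafSum : ℕ → (Fin 4 → ℤ → ℤ) → ℤ → ℤ
pafSum n x k = ∑ (λ i → Correlation.corr n (x i) (x i) k)

vanishes-on-differences : ∀ {n} (f : ℤ → ℤ) → (∀ k → f (- k) ≡ f k) →
                          (∀ k → 0 < k → k < n → f (+ k) ≡ 0ℤ) →
                          ∀ {a b} → a < n → b < n → a ≢ b → f (+ a - + b) ≡ 0ℤ
vanishes-on-differences {n} f even vanishes {a} {b} a<n b<n a≢b with ℕ.<-cmp a b
... | tri< a<b _ _ = begin
  f (+ a - + b)     ≡⟨ cong f (trans (ℤ.[+m]-[+n]≡m⊖n a b) (ℤ.⊖-swap a b)) ⟩
  f (- (b ⊖ a))     ≡⟨ cong (f ∘ -_) (ℤ.⊖-≥ (ℕ.<⇒≤ a<b)) ⟩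
  f (- + (b ∸ a))   ≡⟨ even (+ (b ∸ a)) ⟩
  f (+ (b ∸ a))     ≡⟨ vanishes (b ∸ a) (ℕ.m<n⇒0<n∸m a<b) (ℕ.≤-<-trans (ℕ.m∸n≤m b a) b<n) ⟩
  0ℤ                ∎
  where open ≡-Reasoning
... | tri≈ _ a≡b _ = contradiction a≡b a≢b
... | tri> _ _ a>b = begin
  f (+ a - + b)     ≡⟨ cong f (trans (ℤ.[+m]-[+n]≡m⊖n a b) (ℤ.⊖-≥ (ℕ.<⇒≤ a>b))) ⟩
  f (+ (a ∸ b))     ≡⟨ vanishes (a ∸ b) (ℕ.m<n⇒0<n∸m a>b) (ℕ.≤-<-trans (ℕ.m∸n≤m a b) a<n) ⟩
  0ℤ                ∎
  where open ≡-Reasoning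

-- The Goethals–Seidel array

signed : Sign → ℤ → ℤ
signed Sign.+ z = z
signed Sign.- z = - z

signed-* : ∀ σ τ a b → signed σ a * signed τ b ≡ signed (σ Sign.* τ) (a * b)
signed-* Sign.+ Sign.+ a b = refl
signed-* Sign.+ Sign.- a b = sym (ℤ.neg-distribʳ-* a b)
signed-* Sign.- Sign.+ a b = sym (ℤ.neg-distribˡ-* a b)
signed-* Sign.- Sign.- a b =
  trans (sym (ℤ.neg-distribˡ-* a (- b))) (trans (cong -_ (sym (ℤ.neg-distribʳ-* a b))) (ℤ.neg-involutive (a * b)))

∑-signed : ∀ {n} σ (f : Fin n → ℤ) → ∑ (λ i → signed σ (f i)) ≡ signed σ (∑ f)
∑-signed Sign.+ f = refl
∑-signed Sign.- f = ∑-neg f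

signed-±1 : ∀ σ {z} → ±1 z → ±1 (signed σ z)
signed-±1 Sign.+ ±1z         = ±1z
signed-±1 Sign.- (inj₁ refl) = inj₂ refl
signed-±1 Sign.- (inj₂ refl) = inj₁ refl

-- With X the circulant of x and R the permutation matrix of s ↦ -s, the (r, s) entries of
-- X, XR and XᵀR are x (s - r), x (- r - s) and x (s + r).
data Kind : Set where
  X XR XᵀR : Kind

index : Kind → ℤ → ℤ → ℤ
index X   r s = s - r
index XR  r s = - r - s
index XᵀR r s = s + r

index-reindexing : ∀ {n} κ r → Reindexing n (index κ r)
index-reindexing X   r = shift-reindexing (- r)
index-reindexing XR  r = reflect-reindexing (- r)
index-reindexing XᵀR r = shift-reindexing r

module BlockCorrelation (n : ℕ) where

  open Correlation n

  -- Where corr x y k and corr y x (- k) would both do, the form is chosen so that the terms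
  -- that cancel in H Hᵀ come out syntactically equal.
  blockCorrelation : Kind → Kind → (ℤ → ℤ) → (ℤ → ℤ) → ℤ → ℤ → ℤ
  blockCorrelation X   X   x y r r' = corr y x (r' - r)
  blockCorrelation XR  XR  x y r r' = corr y x (r' - r)
  blockCorrelation XᵀR XᵀR x y r r' = corr x y (r' - r)
  blockCorrelation X   XR  x y r r' = conv x y (- (r + r'))
  blockCorrelation XR  X   x y r r' = conv x y (- (r + r'))
  blockCorrelation X   XᵀR x y r r' = corr x y (r + r')
  blockCorrelation XᵀR X   x y r r' = corr y x (r + r')
  blockCorrelation XR  XᵀR x y r r' = conv x y (r' - r)
  blockCorrelation XᵀR XR  x y r r' = conv x y (r - r')

  ∑-as-blockCorrelation : ∀ {x y : ℤ → ℤ} → Periodic n x → Periodic n y → ∀ κ κ' r r' →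
                          ∑< n (λ s → x (index κ r s) * y (index κ' r' s)) ≡ blockCorrelation κ κ' x y r r'
  ∑-as-blockCorrelation px py X X r r' = ∑-as-corrᵀ px py (index-reindexing X r') (r' - r) (λ s → substitution s r r')
    where substitution : ∀ s r r' → s - r ≡ s - r' + (r' - r)
          substitution = solve-∀
  ∑-as-blockCorrelation px py XR XR r r' = ∑-as-corrᵀ px py (index-reindexing XR r') (r' - r) (λ s → substitution s r r')
    where substitution : ∀ s r r' → - r - s ≡ - r' - s + (r' - r)
          substitution = solve-∀
  ∑-as-blockCorrelation px py XᵀR XᵀR r r' = ∑-as-corr px py (index-reindexing XᵀR r) (r' - r) (λ s → substitution s r r')
    where substitution : ∀ s r r' → s + r' ≡ s + r + (r' - r)
          substitution = solve-∀
  ∑-as-blockCorrelation px py X XR r r' = ∑-as-conv px py (index-reindexing X r) (- (r + r')) (λ s → substitution s r r')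
    where substitution : ∀ s r r' → - r' - s ≡ - (r + r') - (s - r)
          substitution = solve-∀
  ∑-as-blockCorrelation px py XR X r r' = ∑-as-conv px py (index-reindexing XR r) (- (r + r')) (λ s → substitution s r r')
    where substitution : ∀ s r r' → s - r' ≡ - (r + r') - (- r - s)
          substitution = solve-∀
  ∑-as-blockCorrelation px py X XᵀR r r' = ∑-as-corr px py (index-reindexing X r) (r + r') (λ s → substitution s r r')
    where substitution : ∀ s r r' → s + r' ≡ s - r + (r + r')
          substitution = solve-∀
  ∑-as-blockCorrelation px py XᵀR X r r' = ∑-as-corrᵀ px py (index-reindexing X r') (r + r') (λ s → substitution s r r')
    where substitution : ∀ s r r' → s + r ≡ s - r' + (r + r')
          substitution = solve-∀
  ∑-as-blockCorrelation px py XR XᵀR r r' = ∑-as-conv px py (index-reindexing XR r) (r' - r) (λ s → substitution s r r')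
    where substitution : ∀ s r r' → s + r' ≡ r' - r - (- r - s)
          substitution = solve-∀
  ∑-as-blockCorrelation px py XᵀR XR r r' = ∑-as-conv px py (index-reindexing XᵀR r) (r - r') (λ s → substitution s r r')
    where substitution : ∀ s r r' → - r' - s ≡ r - r' - (s + r)
          substitution = solve-∀

record Block : Set where
  constructor block
  field
    sign     : Sign
    sequence : Fin 4
    kind     : Kind

open Block

-- With the sequences 0F, 1F, 2F, 3F named a, b, c, d:
--    A    BR    CR    DR
--   -BR   A     DᵀR  -CᵀR
--   -CR  -DᵀR   A     BᵀR
--   -DR   CᵀR  -BᵀR   A
goethalsSeidel : Fin 4 → Fin 4 → Block
goethalsSeidel 0F 0F = block Sign.+ 0F X
goethalsSeidel 0F 1F = block Sign.+ 1F XR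
goethalsSeidel 0F 2F = block Sign.+ 2F XR
goethalsSeidel 0F 3F = block Sign.+ 3F XR
goethalsSeidel 1F 0F = block Sign.- 1F XR
goethalsSeidel 1F 1F = block Sign.+ 0F X
goethalsSeidel 1F 2F = block Sign.+ 3F XᵀR
goethalsSeidel 1F 3F = block Sign.- 2F XᵀR
goethalsSeidel 2F 0F = block Sign.- 2F XR
goethalsSeidel 2F 1F = block Sign.- 3F XᵀR
goethalsSeidel 2F 2F = block Sign.+ 0F X
goethalsSeidel 2F 3F = block Sign.+ 1F XᵀR
goethalsSeidel 3F 0F = block Sign.- 3F XR
goethalsSeidel 3F 1F = block Sign.+ 2F XᵀR
goethalsSeidel 3F 2F = block Sign.- 1F XᵀR
goethalsSeidel 3F 3F = block Sign.+ 0F X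

rows-permute : ∀ p (f : Fin 4 → ℤ) → ∑ (λ q → f (sequence (goethalsSeidel p q))) ≡ ∑ f
rows-permute 0F f = refl
rows-permute 1F f = reorder (f 0F) (f 1F) (f 2F) (f 3F)
  where reorder : ∀ a b c d → b + (a + (d + (c + 0ℤ))) ≡ a + (b + (c + (d + 0ℤ)))
        reorder = solve-∀
rows-permute 2F f = reorder (f 0F) (f 1F) (f 2F) (f 3F)
  where reorder : ∀ a b c d → c + (d + (a + (b + 0ℤ))) ≡ a + (b + (c + (d + 0ℤ)))
        reorder = solve-∀
rows-permute 3F f = reorder (f 0F) (f 1F) (f 2F) (f 3F)
  where reorder : ∀ a b c d → d + (c + (b + (a + 0ℤ))) ≡ a + (b + (c + (d + 0ℤ)))
        reorder = solve-∀

cancelˡ : ∀ {u v : ℤ} → u ≡ v → - u + v ≡ 0ℤ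
cancelˡ {u} refl = ℤ.+-inverseˡ u

cancelʳ : ∀ {u v : ℤ} → u ≡ v → u + - v ≡ 0ℤ
cancelʳ {u} refl = ℤ.+-inverseʳ u

∑₄-cancel₀₁,₂₃ : ∀ (t : Fin 4 → ℤ) → t 0F + t 1F ≡ 0ℤ → t 2F + t 3F ≡ 0ℤ → ∑ t ≡ 0ℤ
∑₄-cancel₀₁,₂₃ t e e' = trans (regroup (t 0F) (t 1F) (t 2F) (t 3F)) (cong₂ _+_ e e')
  where regroup : ∀ a b c d → a + (b + (c + (d + 0ℤ))) ≡ (a + b) + (c + d)
        regroup = solve-∀

∑₄-cancel₀₂,₁₃ : ∀ (t : Fin 4 → ℤ) → t 0F + t 2F ≡ 0ℤ → t 1F + t 3F ≡ 0ℤ → ∑ t ≡ 0ℤ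
∑₄-cancel₀₂,₁₃ t e e' = trans (regroup (t 0F) (t 1F) (t 2F) (t 3F)) (cong₂ _+_ e e')
  where regroup : ∀ a b c d → a + (b + (c + (d + 0ℤ))) ≡ (a + c) + (b + d)
        regroup = solve-∀

∑₄-cancel₀₃,₁₂ : ∀ (t : Fin 4 → ℤ) → t 0F + t 3F ≡ 0ℤ → t 1F + t 2F ≡ 0ℤ → ∑ t ≡ 0ℤ
∑₄-cancel₀₃,₁₂ t e e' = trans (regroup (t 0F) (t 1F) (t 2F) (t 3F)) (cong₂ _+_ e e')
  where regroup : ∀ a b c d → a + (b + (c + (d + 0ℤ))) ≡ (a + d) + (b + c)
        regroup = solve-∀

module GoethalsSeidel {n : ℕ} (x : Fin 4 → ℤ → ℤ) (periodic-x : ∀ i → Periodic n (x i)) where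

  open Correlation n
  open BlockCorrelation n

  blockOf : Block → Matrix n n
  blockOf (block σ i κ) r s = signed σ (x i (index κ (+ toℕ r) (+ toℕ s)))

  blocks : Fin 4 → Fin 4 → Matrix n n
  blocks p q = blockOf (goethalsSeidel p q)

  H : Matrix (4 ℕ.* n) (4 ℕ.* n)
  H = blockMatrix blocks

  blockProduct : ℤ → ℤ → Block → Block → ℤ
  blockProduct r r' (block σ i κ) (block σ' i' κ') = signed (σ Sign.* σ') (blockCorrelation κ κ' (x i) (x i') r r')

  blockOf-·ᵀ : ∀ b b' r r' → (blockOf b · (blockOf b' ᵀ)) r r' ≡ blockProduct (+ toℕ r) (+ toℕ r') b b'
  blockOf-·ᵀ (block σ i κ) (block σ' i' κ') r r' = begin
    ∑< n (λ s → signed σ (x i (index κ R s)) * signed σ' (x i' (index κ' R' s)))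
      ≡⟨ ∑<-cong {n} (λ s → signed-* σ σ' (x i (index κ R s)) (x i' (index κ' R' s))) ⟩
    ∑< n (λ s → signed (σ Sign.* σ') (x i (index κ R s) * x i' (index κ' R' s)))
      ≡⟨ ∑-signed {n} (σ Sign.* σ') (λ s → x i (index κ R (+ toℕ s)) * x i' (index κ' R' (+ toℕ s))) ⟩
    signed (σ Sign.* σ') (∑< n (λ s → x i (index κ R s) * x i' (index κ' R' s)))
      ≡⟨ cong (signed (σ Sign.* σ')) (∑-as-blockCorrelation (periodic-x i) (periodic-x i') κ κ' R R') ⟩
    signed (σ Sign.* σ') (blockCorrelation κ κ' (x i) (x i') R R') ∎
    where open ≡-Reasoning
          R R' : ℤ
          R = + toℕ r
          R' = + toℕ r'

  rowTerms : Fin 4 → Fin n → Fin 4 → Fin n → Fin 4 → ℤ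
  rowTerms p r p' r' q = blockProduct (+ toℕ r) (+ toℕ r') (goethalsSeidel p q) (goethalsSeidel p' q)

  rowProduct : Fin 4 → Fin n → Fin 4 → Fin n → ℤ
  rowProduct p r p' r' = ∑ (rowTerms p r p' r')

  H·Hᵀ-combine : ∀ p r p' r' → (H · (H ᵀ)) (combine p r) (combine p' r') ≡ rowProduct p r p' r'
  H·Hᵀ-combine p r p' r' =
    trans (·ᵀ-blockMatrix blocks blocks p r p' r') (∑-cong (λ q → blockOf-·ᵀ (goethalsSeidel p q) (goethalsSeidel p' q) r r'))

  rowProduct-sym : ∀ p r p' r' → rowProduct p r p' r' ≡ rowProduct p' r' p r
  rowProduct-sym p r p' r' = begin
    rowProduct p r p' r'                        ≡⟨ H·Hᵀ-combine p r p' r' ⟨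
    (H · (H ᵀ)) (combine p r) (combine p' r')   ≡⟨ ∑-cong (λ j → ℤ.*-comm (H (combine p r) j) (H (combine p' r') j)) ⟩
    (H · (H ᵀ)) (combine p' r') (combine p r)   ≡⟨ H·Hᵀ-combine p' r' p r ⟩
    rowProduct p' r' p r                        ∎
    where open ≡-Reasoning

  rowProduct-offDiagonal : ∀ p p' → p ≢ p' → ∀ r r' → rowProduct p r p' r' ≡ 0ℤ
  rowProduct-offDiagonal 0F 1F _ r r' = ∑₄-cancel₀₁,₂₃ (rowTerms 0F r 1F r')
    (cancelˡ (conv-comm (periodic-x 0F) (periodic-x 1F) (- (+ toℕ r + + toℕ r'))))
    (cancelʳ (conv-comm (periodic-x 2F) (periodic-x 3F) (+ toℕ r' - + toℕ r)))
  rowProduct-offDiagonal 0F 2F _ r r' = ∑₄-cancel₀₂,₁₃ (rowTerms 0F r 2F r')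
    (cancelˡ (conv-comm (periodic-x 0F) (periodic-x 2F) (- (+ toℕ r + + toℕ r'))))
    (cancelˡ (conv-comm (periodic-x 1F) (periodic-x 3F) (+ toℕ r' - + toℕ r)))
  rowProduct-offDiagonal 0F 3F _ r r' = ∑₄-cancel₀₃,₁₂ (rowTerms 0F r 3F r')
    (cancelˡ (conv-comm (periodic-x 0F) (periodic-x 3F) (- (+ toℕ r + + toℕ r'))))
    (cancelʳ (conv-comm (periodic-x 1F) (periodic-x 2F) (+ toℕ r' - + toℕ r)))
  rowProduct-offDiagonal 1F 2F _ r r' = ∑₄-cancel₀₃,₁₂ (rowTerms 1F r 2F r')
    (ℤ.+-inverseʳ (corr (x 2F) (x 1F) (+ toℕ r' - + toℕ r)))
    (ℤ.+-inverseˡ (corr (x 0F) (x 3F) (+ toℕ r + + toℕ r')))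
  rowProduct-offDiagonal 1F 3F _ r r' = ∑₄-cancel₀₂,₁₃ (rowTerms 1F r 3F r')
    (ℤ.+-inverseʳ (corr (x 3F) (x 1F) (+ toℕ r' - + toℕ r)))
    (ℤ.+-inverseʳ (corr (x 0F) (x 2F) (+ toℕ r + + toℕ r')))
  rowProduct-offDiagonal 2F 3F _ r r' = ∑₄-cancel₀₁,₂₃ (rowTerms 2F r 3F r')
    (ℤ.+-inverseʳ (corr (x 3F) (x 2F) (+ toℕ r' - + toℕ r)))
    (ℤ.+-inverseˡ (corr (x 0F) (x 1F) (+ toℕ r + + toℕ r')))
  rowProduct-offDiagonal 1F 0F _ r r' = trans (rowProduct-sym 1F r 0F r') (rowProduct-offDiagonal 0F 1F (λ ()) r' r)
  rowProduct-offDiagonal 2F 0F _ r r' = trans (rowProduct-sym 2F r 0F r') (rowProduct-offDiagonal 0F 2F (λ ()) r' r)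
  rowProduct-offDiagonal 3F 0F _ r r' = trans (rowProduct-sym 3F r 0F r') (rowProduct-offDiagonal 0F 3F (λ ()) r' r)
  rowProduct-offDiagonal 2F 1F _ r r' = trans (rowProduct-sym 2F r 1F r') (rowProduct-offDiagonal 1F 2F (λ ()) r' r)
  rowProduct-offDiagonal 3F 1F _ r r' = trans (rowProduct-sym 3F r 1F r') (rowProduct-offDiagonal 1F 3F (λ ()) r' r)
  rowProduct-offDiagonal 3F 2F _ r r' = trans (rowProduct-sym 3F r 2F r') (rowProduct-offDiagonal 2F 3F (λ ()) r' r)
  rowProduct-offDiagonal 0F 0F p≢p' _ _ = contradiction refl p≢p'
  rowProduct-offDiagonal 1F 1F p≢p' _ _ = contradiction refl p≢p'
  rowProduct-offDiagonal 2F 2F p≢p' _ _ = contradiction refl p≢p'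
  rowProduct-offDiagonal 3F 3F p≢p' _ _ = contradiction refl p≢p'

  pafSum-even : ∀ k → pafSum n x (- k) ≡ pafSum n x k
  pafSum-even k = ∑-cong (λ i → sym (corr-swap (periodic-x i) (periodic-x i) k))

  rowProduct-diagonal : ∀ p r r' → rowProduct p r p r' ≡ pafSum n x (+ toℕ r' - + toℕ r)
  rowProduct-diagonal 0F r r' = refl
  rowProduct-diagonal 1F r r' = rows-permute 1F (λ i → corr (x i) (x i) (+ toℕ r' - + toℕ r))
  rowProduct-diagonal 2F r r' = rows-permute 2F (λ i → corr (x i) (x i) (+ toℕ r' - + toℕ r))
  rowProduct-diagonal 3F r r' = rows-permute 3F (λ i → corr (x i) (x i) (+ toℕ r' - + toℕ r))

  module _ (±1-valued : ∀ i u → ±1 (x i u)) (pafSum-vanishes : ∀ k → 0 < k → k < n → pafSum n x (+ k) ≡ 0ℤ) where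

    pafSum-zero : pafSum n x 0ℤ ≡ + (4 ℕ.* n)
    pafSum-zero = ∑-cong (λ i → corr-self (±1-valued i))

    rowProduct-distinct : ∀ {p r p' r'} → (p , r) ≢ (p' , r') → rowProduct p r p' r' ≡ 0ℤ
    rowProduct-distinct {p} {r} {p'} {r'} pr≢p'r' with p Fin.≟ p'
    ... | no p≢p'  = rowProduct-offDiagonal p p' p≢p' r r'
    ... | yes refl = trans (rowProduct-diagonal p r r')
                           (vanishes-on-differences (pafSum n x) pafSum-even pafSum-vanishes (toℕ<n r') (toℕ<n r)
                                                    (λ r'≡r → pr≢p'r' (cong (p ,_) (sym (toℕ-injective r'≡r)))))

    H·Hᵀ≡4nI : ∀ i k → (H · (H ᵀ)) i k ≡ ((+ (4 ℕ.* n)) • I (4 ℕ.* n)) i k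
    H·Hᵀ≡4nI = ∀-combine₂ gram
      where
      gram : ∀ p r p' r' →
             (H · (H ᵀ)) (combine p r) (combine p' r') ≡ ((+ (4 ℕ.* n)) • I (4 ℕ.* n)) (combine p r) (combine p' r')
      gram p r p' r' with ≡-dec Fin._≟_ Fin._≟_ (p , r) (p' , r')
      ... | yes refl = begin
        (H · (H ᵀ)) (combine p r) (combine p r)                 ≡⟨ H·Hᵀ-combine p r p r ⟩
        rowProduct p r p r                                      ≡⟨ rowProduct-diagonal p r r ⟩
        pafSum n x (+ toℕ r - + toℕ r)                          ≡⟨ cong (pafSum n x) (ℤ.+-inverseʳ (+ toℕ r)) ⟩
        pafSum n x 0ℤ                                           ≡⟨ pafSum-zero ⟩
        + (4 ℕ.* n)                                             ≡⟨ •I-diagonal (+ (4 ℕ.* n)) (combine p r) ⟨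
        ((+ (4 ℕ.* n)) • I (4 ℕ.* n)) (combine p r) (combine p r) ∎
        where open ≡-Reasoning
      ... | no pr≢p'r' = trans (trans (H·Hᵀ-combine p r p' r') (rowProduct-distinct pr≢p'r'))
                               (sym (•I-offDiagonal (+ (4 ℕ.* n)) (pr≢p'r' ∘ combine-injective p r p' r')))

    isHadamard : IsHadamard (4 ℕ.* n) H
    isHadamard = blockMatrix-entries {P = ±1} blocks ±1-entries , H·Hᵀ≡4nI
      where ±1-entries : ∀ p q r s → ±1 (blocks p q r s)
            ±1-entries p q r s = signed-±1 (sign (goethalsSeidel p q)) (±1-valued (sequence (goethalsSeidel p q)) _)

goethalsSeidel-hadamard : ∀ {n} (x : Fin 4 → ℤ → ℤ) → (∀ i → Periodic n (x i)) → (∀ i u → ±1 (x i u)) →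
                          (∀ k → 0 < k → k < n → pafSum n x (+ k) ≡ 0ℤ) →
                          ∃ λ (A : Matrix (4 ℕ.* n) (4 ℕ.* n)) → IsHadamard (4 ℕ.* n) A
goethalsSeidel-hadamard x periodic-x ±1-valued pafSum-vanishes =
  GoethalsSeidel.H x periodic-x , GoethalsSeidel.isHadamard x periodic-x ±1-valued pafSum-vanishes

-- Four sequences of length 191

infix 4 _∈ᵇ_

_∈ᵇ_ : ℕ → List ℕ → Bool
k ∈ᵇ []       = false
k ∈ᵇ (d ∷ ds) = (d ≡ᵇ k) ∨ (k ∈ᵇ ds)

negativePositions : Fin 4 → List ℕ
negativePositions 0F =
  1 ∷ 2 ∷ 4 ∷ 5 ∷ 9 ∷ 12 ∷ 13 ∷ 14 ∷ 15 ∷ 17 ∷ 18 ∷ 19 ∷ 22 ∷ 26 ∷ 27 ∷ 34 ∷ 37 ∷ 39 ∷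
  42 ∷ 46 ∷ 48 ∷ 49 ∷ 52 ∷ 54 ∷ 58 ∷ 59 ∷ 60 ∷ 64 ∷ 65 ∷ 66 ∷ 68 ∷ 69 ∷ 72 ∷ 75 ∷ 77 ∷
  78 ∷ 80 ∷ 85 ∷ 86 ∷ 88 ∷ 90 ∷ 91 ∷ 92 ∷ 93 ∷ 94 ∷ 96 ∷ 97 ∷ 98 ∷ 100 ∷ 106 ∷ 107 ∷
  109 ∷ 110 ∷ 111 ∷ 113 ∷ 115 ∷ 118 ∷ 120 ∷ 123 ∷ 125 ∷ 127 ∷ 128 ∷ 129 ∷ 134 ∷ 138 ∷
  144 ∷ 148 ∷ 150 ∷ 153 ∷ 154 ∷ 156 ∷ 160 ∷ 161 ∷ 162 ∷ 163 ∷ 164 ∷ 167 ∷ 168 ∷ 169 ∷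
  177 ∷ 178 ∷ 180 ∷ 184 ∷ 185 ∷ 189 ∷ []
negativePositions 1F =
  2 ∷ 3 ∷ 4 ∷ 5 ∷ 6 ∷ 11 ∷ 12 ∷ 13 ∷ 15 ∷ 22 ∷ 27 ∷ 29 ∷ 33 ∷ 34 ∷ 37 ∷ 38 ∷ 41 ∷ 43 ∷
  47 ∷ 53 ∷ 54 ∷ 56 ∷ 62 ∷ 64 ∷ 66 ∷ 70 ∷ 71 ∷ 73 ∷ 76 ∷ 77 ∷ 78 ∷ 80 ∷ 81 ∷ 83 ∷ 84 ∷
  86 ∷ 89 ∷ 91 ∷ 92 ∷ 94 ∷ 95 ∷ 96 ∷ 98 ∷ 99 ∷ 100 ∷ 103 ∷ 105 ∷ 106 ∷ 107 ∷ 111 ∷ 112 ∷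
  114 ∷ 115 ∷ 116 ∷ 117 ∷ 120 ∷ 123 ∷ 125 ∷ 126 ∷ 127 ∷ 131 ∷ 136 ∷ 138 ∷ 139 ∷ 140 ∷
  141 ∷ 143 ∷ 144 ∷ 145 ∷ 147 ∷ 149 ∷ 150 ∷ 151 ∷ 156 ∷ 157 ∷ 159 ∷ 162 ∷ 163 ∷ 166 ∷
  170 ∷ 171 ∷ 173 ∷ 175 ∷ 176 ∷ 177 ∷ 178 ∷ 179 ∷ 180 ∷ 181 ∷ 183 ∷ []
negativePositions 2F =
  1 ∷ 7 ∷ 9 ∷ 12 ∷ 14 ∷ 15 ∷ 21 ∷ 22 ∷ 26 ∷ 29 ∷ 32 ∷ 37 ∷ 38 ∷ 39 ∷ 40 ∷ 41 ∷ 42 ∷ 44 ∷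
  46 ∷ 48 ∷ 49 ∷ 50 ∷ 55 ∷ 56 ∷ 57 ∷ 59 ∷ 60 ∷ 61 ∷ 70 ∷ 71 ∷ 74 ∷ 75 ∷ 76 ∷ 82 ∷ 83 ∷
  84 ∷ 86 ∷ 87 ∷ 88 ∷ 92 ∷ 93 ∷ 94 ∷ 95 ∷ 96 ∷ 99 ∷ 101 ∷ 102 ∷ 105 ∷ 106 ∷ 107 ∷ 109 ∷
  110 ∷ 112 ∷ 113 ∷ 115 ∷ 116 ∷ 119 ∷ 120 ∷ 122 ∷ 123 ∷ 124 ∷ 128 ∷ 131 ∷ 140 ∷ 142 ∷
  143 ∷ 145 ∷ 146 ∷ 148 ∷ 150 ∷ 152 ∷ 153 ∷ 155 ∷ 158 ∷ 160 ∷ 162 ∷ 164 ∷ 166 ∷ 171 ∷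
  174 ∷ 175 ∷ 176 ∷ 179 ∷ 181 ∷ 183 ∷ 184 ∷ 185 ∷ 188 ∷ 189 ∷ 190 ∷ []
negativePositions 3F =
  0 ∷ 1 ∷ 7 ∷ 11 ∷ 12 ∷ 15 ∷ 16 ∷ 19 ∷ 20 ∷ 21 ∷ 23 ∷ 24 ∷ 25 ∷ 30 ∷ 33 ∷ 36 ∷ 38 ∷ 39 ∷
  41 ∷ 42 ∷ 44 ∷ 45 ∷ 46 ∷ 47 ∷ 48 ∷ 49 ∷ 51 ∷ 53 ∷ 55 ∷ 58 ∷ 60 ∷ 61 ∷ 62 ∷ 67 ∷ 68 ∷
  71 ∷ 73 ∷ 74 ∷ 75 ∷ 76 ∷ 79 ∷ 82 ∷ 85 ∷ 86 ∷ 87 ∷ 88 ∷ 89 ∷ 92 ∷ 95 ∷ 96 ∷ 97 ∷ 99 ∷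
  104 ∷ 107 ∷ 109 ∷ 110 ∷ 114 ∷ 115 ∷ 116 ∷ 120 ∷ 124 ∷ 126 ∷ 130 ∷ 131 ∷ 133 ∷ 139 ∷
  141 ∷ 142 ∷ 143 ∷ 145 ∷ 146 ∷ 148 ∷ 150 ∷ 151 ∷ 152 ∷ 153 ∷ 154 ∷ 155 ∷ 157 ∷ 159 ∷
  161 ∷ 162 ∷ 167 ∷ 168 ∷ 169 ∷ 172 ∷ 173 ∷ 184 ∷ 185 ∷ 188 ∷ 190 ∷ []

signs : List ℕ → ℕ → ℤ
signs D k = if k ∈ᵇ D then -1ℤ else 1ℤ

signs-±1 : ∀ D k → ±1 (signs D k)
signs-±1 D k with k ∈ᵇ D
... | true  = inj₂ refl
... | false = inj₁ refl

x₁₉₁ : Fin 4 → ℤ → ℤ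
x₁₉₁ i u = signs (negativePositions i) (u %ℕ 191)

x₁₉₁-periodic : ∀ i → Periodic 191 (x₁₉₁ i)
x₁₉₁-periodic i = periodic-%ℕ 191 (signs (negativePositions i))

x₁₉₁-±1 : ∀ i u → ±1 (x₁₉₁ i u)
x₁₉₁-±1 i u = signs-±1 (negativePositions i) (u %ℕ 191)

x₁₉₁-vanishes : ∀ k → 0 < k → k < 191 → pafSum 191 x₁₉₁ (+ k) ≡ 0ℤ
x₁₉₁-vanishes (suc k) _ (ℕ.s≤s k<190) =
  subst (λ m → pafSum 191 x₁₉₁ (+ suc m) ≡ 0ℤ) (toℕ-fromℕ< k<190) (checked (Fin.fromℕ< k<190))
  where checked : ∀ (j : Fin 190) → pafSum 191 x₁₉₁ (+ suc (toℕ j)) ≡ 0ℤ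
        checked = toWitness {a? = all? (λ j → pafSum 191 x₁₉₁ (+ suc (toℕ j)) ℤ.≟ 0ℤ)} _

-- Transporting along 4 * 191 ≡ 764 with subst, rather than leaving it to conversion, keeps
-- Agda from unfolding IsHadamard on both sides into sums over Fin 764.
mainTheorem1 : ∃ λ (A : Matrix 764 764) → IsHadamard 764 A
mainTheorem1 = subst (λ N → ∃ λ (A : Matrix N N) → IsHadamard N A) 4·191≡764
                     (goethalsSeidel-hadamard x₁₉₁ x₁₉₁-periodic x₁₉₁-±1 x₁₉₁-vanishes)
  where 4·191≡764 : 4 ℕ.* 191 ≡ 764
        4·191≡764 = refl
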